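{- Let $\mathfrak{X}$ be a primitive coherent configuration, let $I$ be a nonempty set of nondiagonal colors, let $n_I=\sum_{i\in I}n_i$, and let $J$ be the set of colors $j\in\{0,\ldots,r-1\}$ with $n_j\le n_I/2$. Then \[ \sum_{j\in J} n_j \le 2\max\{D(i): i\in I\}. \]
   Context: A primitive coherent configuration (PCC) of rank $r$ on a finite set $V$ is a map $c:V\times V\to\{0,\ldots,r-1\}$ such that: color $0$ is exactly the set of diagonal pairs; for every color $i$ there is $i^*$ with $c(u,v)=i$ iff $c(v,u)=i^*$; for all $i,j,k$ there is $p^i_{jk}$ such that whenever $c(u,v)=i$, exactly $p^i_{jk}$ vertices $w$ satisfy $c(u,w)=j$, $c(w,v)=k$; and each digraph $(V,\{(u,v):c(u,v)=i\})$, $i\ne0$, is strongly connected. $n_i=|\{v:c(u,v)=i\}|$. The distinguishing number $D(i)$ is the number of vertices $w$ with $c(w,u)\ne c(w,v)$ for any fixed $u,v$ with $c(u,v)=i$. -}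

module Defs where

open import Data.Nat using (ℕ; zero; suc; _+_; _*_; _≤_; _⊔_)
open import Data.Fin using (Fin; zero; suc; _≟_)
open import Data.Fin.Subset using (Subset; _∈_; _∉_; Nonempty)
open import Data.Fin.Subset.Properties using (_∈?_)
open import Data.Bool using (Bool; true; false; if_then_else_; _∧_; not)
open import Data.Product using (Σ; ∃; _×_; _,_)
open import Relation.Binary.PropositionalEquality using (_≡_; _≢_)
open import Relation.Nullary using (¬_)
open import Relation.Nullary.Decidable using (⌊_⌋)
open import Function.Bundles using (_⇔_)

∑ : ∀ {k} → (Fin k → ℕ) → ℕ
∑ {zero}  f = 0
∑ {suc k} f = f zero + ∑ (λ i → f (suc i))

maxOver : ∀ {k} → (Fin k → ℕ) → ℕ
maxOver {zero}  f = 0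
maxOver {suc k} f = f zero ⊔ maxOver (λ i → f (suc i))

count : ∀ {k} → (Fin k → Bool) → ℕ
count P = ∑ (λ x → if P x then 1 else 0)

_==_ : ∀ {k} → Fin k → Fin k → Bool
a == b = ⌊ a ≟ b ⌋

data Reach {n : ℕ} (E : Fin n → Fin n → Set) : Fin n → Fin n → Set where
  here : ∀ {u} → Reach E u u
  step : ∀ {u w v} → E u w → Reach E w v → Reach E u v

StronglyConnected : ∀ {n} → (Fin n → Fin n → Set) → Set
StronglyConnected E = ∀ u v → Reach E u v

Coloring : ℕ → ℕ → Set
Coloring n r = Fin n → Fin n → Fin r

record IsPCC {n r : ℕ} (c : Coloring n (suc r)) : Set where
  field
    diagonal     : ∀ u v → (c u v ≡ zero ⇔ u ≡ v)
    converse     : ∀ i → ∃ λ i* → ∀ u v → (c u v ≡ i ⇔ c v u ≡ i*)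
    intersection : ∀ i j k → ∃ λ p → ∀ u v → c u v ≡ i →
                     count (λ w → (c u w == j) ∧ (c w v == k)) ≡ p
    connected    : ∀ i → i ≢ zero → StronglyConnected (λ u v → c u v ≡ i)

-- n_i = |{v : c(u,v) = i}| for a fixed vertex u.
valencyAt : ∀ {n r} → Coloring n r → Fin n → Fin r → ℕ
valencyAt c u i = count (λ v → c u v == i)

distinguishing : ∀ {n r} → Coloring n r → Fin n → Fin n → ℕ
distinguishing c u v = count (λ w → not (c w u == c w v))

sumOn : ∀ {r} → Subset r → (Fin r → ℕ) → ℕ
sumOn I f = ∑ (λ i → if ⌊ i ∈? I ⌋ then f i else 0)

maxOn : ∀ {r} → Subset r → (Fin r → ℕ) → ℕ
maxOn I f = maxOver (λ i → if ⌊ i ∈? I ⌋ then f i else 0)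

-- Double counting. For u fixed, sum over the I-neighbours v of u the number D(c(u,v)) of
-- vertices w separating u from v; this is at most n_I · max_I D. Counted by w instead, every w
-- separates u from all I-neighbours v except those with c(w,v) = c(w,u), of which there are
-- n_{c(w,u)} = n_{c(u,w)}; so w contributes at least n_I − n_{c(u,w)}, which is ≥ n_I / 2
-- whenever c(u,w) ∈ J. The number of such w is ∑_{j∈J} n_j, whence ∑_{j∈J} n_j · n_I ≤ 2 n_I · max_I D;
-- if n_I = 0 then J only contains colors of valency 0.
module Submission where

open import Defs
open import Data.Nat using (ℕ; suc; _*_; _≤_; _≤?_)
open import Data.Fin using (Fin; zero)
open import Data.Fin.Subset using (Subset; _∉_; Nonempty)
open import Data.Bool using (if_then_else_)
open import Relation.Binary.PropositionalEquality using (_≡_)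
open import Relation.Nullary.Decidable using (⌊_⌋)

open import Data.Nat.Properties using (+-*-semiring)
open import Algebra.Properties.Semiring.Sum +-*-semiring
  using (sum; sum-cong-≗; *-distribˡ-sum; *-distribʳ-sum)
  renaming (∑-comm to sum-comm; ∑-distrib-+ to sum-distrib-+)
open import Data.Bool using (Bool; true; false; _∧_; not)
open import Data.Bool.Properties using (∧-idem)
open import Data.Fin using (suc; _≟_)
open import Data.Fin.Properties using (nonZeroIndex)
open import Data.Fin.Subset.Properties using (_∈?_)
open import Data.Nat using (zero; _+_; z≤n)
open import Data.Nat.Properties
  using (+-identityʳ; +-mono-≤; +-monoʳ-≤; +-cancelʳ-≤; *-comm; *-assoc; *-distribˡ-+; *-monoʳ-≤;
         *-cancelˡ-≡; *-cancelʳ-≤; ≤-refl; ≤-trans; ≤-reflexive; m≤m⊔n; m≤n⊔m; module ≤-Reasoning)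
open import Data.Product using (proj₁; proj₂)
open import Function.Bundles using (mk⇔; module Equivalence)
open import Relation.Binary.PropositionalEquality using (refl; sym; trans; cong; cong₂; module ≡-Reasoning)
open import Relation.Nullary.Decidable using (yes; no; does-⇔; isYes≗does; ⌊⌋-map′)

∑≡sum : ∀ {k} (f : Fin k → ℕ) → ∑ f ≡ sum f
∑≡sum {zero}  f = refl
∑≡sum {suc k} f = cong (f zero +_) (∑≡sum (λ i → f (suc i)))

∑-cong : ∀ {k} {f g : Fin k → ℕ} → (∀ i → f i ≡ g i) → ∑ f ≡ ∑ g
∑-cong {f = f} {g} f≗g = trans (∑≡sum f) (trans (sum-cong-≗ f≗g) (sym (∑≡sum g)))

∑-mono-≤ : ∀ {k} {f g : Fin k → ℕ} → (∀ i → f i ≤ g i) → ∑ f ≤ ∑ g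
∑-mono-≤ {zero}  f≤g = z≤n
∑-mono-≤ {suc k} f≤g = +-mono-≤ (f≤g zero) (∑-mono-≤ (λ i → f≤g (suc i)))

∑-const : ∀ {k} a → ∑ {k} (λ _ → a) ≡ k * a
∑-const {zero}  a = refl
∑-const {suc k} a = cong (a +_) (∑-const {k} a)

∑-0 : ∀ {k} → ∑ {k} (λ _ → 0) ≡ 0
∑-0 {zero}  = refl
∑-0 {suc k} = ∑-0 {k}

∑-distrib-+ : ∀ {k} (f g : Fin k → ℕ) → ∑ (λ i → f i + g i) ≡ ∑ f + ∑ g
∑-distrib-+ f g =
  trans (∑≡sum (λ i → f i + g i)) (trans (sum-distrib-+ f g) (sym (cong₂ _+_ (∑≡sum f) (∑≡sum g))))

*-distribˡ-∑ : ∀ {k} a (f : Fin k → ℕ) → a * ∑ f ≡ ∑ (λ i → a * f i)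
*-distribˡ-∑ a f = trans (cong (a *_) (∑≡sum f)) (trans (*-distribˡ-sum a f) (sym (∑≡sum (λ i → a * f i))))

*-distribʳ-∑ : ∀ {k} a (f : Fin k → ℕ) → ∑ f * a ≡ ∑ (λ i → f i * a)
*-distribʳ-∑ a f = trans (cong (_* a) (∑≡sum f)) (trans (*-distribʳ-sum a f) (sym (∑≡sum (λ i → f i * a))))

∑-comm : ∀ {k l} (f : Fin k → Fin l → ℕ) → ∑ (λ i → ∑ (f i)) ≡ ∑ (λ j → ∑ (λ i → f i j))
∑-comm f = trans (∑∑≡sumsum f) (trans (sum-comm f) (sym (∑∑≡sumsum (λ j i → f i j))))
  where
  ∑∑≡sumsum : ∀ {k l} (g : Fin k → Fin l → ℕ) → ∑ (λ i → ∑ (g i)) ≡ sum (λ i → sum (g i))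
  ∑∑≡sumsum g = trans (∑-cong (λ i → ∑≡sum (g i))) (∑≡sum (λ i → sum (g i)))

≤-maxOver : ∀ {k} (f : Fin k → ℕ) i → f i ≤ maxOver f
≤-maxOver f zero    = m≤m⊔n _ _
≤-maxOver f (suc i) = ≤-trans (≤-maxOver (λ j → f (suc j)) i) (m≤n⊔m (f zero) _)

𝟙 : Bool → ℕ
𝟙 b = if b then 1 else 0

if-else-0≡𝟙* : ∀ b x → (if b then x else 0) ≡ 𝟙 b * x
if-else-0≡𝟙* true  x = sym (+-identityʳ x)
if-else-0≡𝟙* false x = refl

𝟙-∧ : ∀ a b → 𝟙 (a ∧ b) ≡ 𝟙 a * 𝟙 b
𝟙-∧ true  b = sym (+-identityʳ (𝟙 b))
𝟙-∧ false b = refl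

𝟙*-monoʳ-≤ : ∀ b {x y} → (if b then x else 0) ≤ y → 𝟙 b * x ≤ 𝟙 b * y
𝟙*-monoʳ-≤ true  x≤y = +-mono-≤ x≤y ≤-refl
𝟙*-monoʳ-≤ false _   = z≤n

count-split : ∀ {k} (P Q : Fin k → Bool) → count P ≤ count (λ v → P v ∧ not (Q v)) + count Q
count-split P Q = ≤-trans (∑-mono-≤ (λ v → split (P v) (Q v)))
                          (≤-reflexive (∑-distrib-+ (λ v → 𝟙 (P v ∧ not (Q v))) (λ v → 𝟙 (Q v))))
  where
  split : ∀ a e → 𝟙 a ≤ 𝟙 (a ∧ not e) + 𝟙 e
  split true  true  = ≤-refl
  split true  false = ≤-refl
  split false e     = z≤n

==-cong : ∀ {k l} {a b : Fin k} {a′ b′ : Fin l} → (a ≡ b → a′ ≡ b′) → (a′ ≡ b′ → a ≡ b) →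
          (a == b) ≡ (a′ == b′)
==-cong {a = a} {b} {a′} {b′} to from =
  trans (isYes≗does (a ≟ b)) (trans (does-⇔ (mk⇔ to from) (a ≟ b) (a′ ≟ b′)) (sym (isYes≗does (a′ ≟ b′))))

==-sym : ∀ {k} (a b : Fin k) → (a == b) ≡ (b == a)
==-sym a b = ==-cong sym sym

∑-delta : ∀ {k} (g : Fin k → ℕ) x → ∑ (λ j → 𝟙 (x == j) * g j) ≡ g x
∑-delta {suc k} g zero = trans (cong₂ _+_ (+-identityʳ (g zero)) (∑-0 {k})) (+-identityʳ (g zero))
∑-delta g (suc x) =
  trans (∑-cong (λ j → cong (λ b → 𝟙 b * g (suc j)) (⌊⌋-map′ _ _ (x ≟ j)))) (∑-delta (λ j → g (suc j)) x)

count-fibres : ∀ {k l} (P : Fin l → Bool) (x : Fin k → Fin l) →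
               ∑ (λ j → if P j then count (λ v → x v == j) else 0) ≡ count (λ v → P (x v))
count-fibres P x = begin
  ∑ (λ j → if P j then count (λ v → x v == j) else 0)
    ≡⟨ ∑-cong (λ j → trans (if-else-0≡𝟙* (P j) _) (*-distribˡ-∑ (𝟙 (P j)) (λ v → 𝟙 (x v == j)))) ⟩
  ∑ (λ j → ∑ (λ v → 𝟙 (P j) * 𝟙 (x v == j)))
    ≡⟨ ∑-comm (λ j v → 𝟙 (P j) * 𝟙 (x v == j)) ⟩
  ∑ (λ v → ∑ (λ j → 𝟙 (P j) * 𝟙 (x v == j)))
    ≡⟨ ∑-cong (λ v → trans (∑-cong (λ j → *-comm (𝟙 (P j)) _)) (∑-delta (λ j → 𝟙 (P j)) (x v))) ⟩
  count (λ v → P (x v)) ∎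
  where open ≡-Reasoning

∑-𝟙*-≤-count* : ∀ {k l} (P : Fin l → Bool) (g : Fin l → ℕ) (x : Fin k → Fin l) {M} →
                (∀ i → (if P i then g i else 0) ≤ M) →
                ∑ (λ v → 𝟙 (P (x v)) * g (x v)) ≤ count (λ v → P (x v)) * M
∑-𝟙*-≤-count* P g x {M} g≤M = begin
  ∑ (λ v → 𝟙 (P (x v)) * g (x v)) ≤⟨ ∑-mono-≤ (λ v → 𝟙*-monoʳ-≤ (P (x v)) (g≤M (x v))) ⟩
  ∑ (λ v → 𝟙 (P (x v)) * M)        ≡⟨ sym (*-distribʳ-∑ M (λ v → 𝟙 (P (x v)))) ⟩
  count (λ v → P (x v)) * M        ∎
  where open ≤-Reasoning

≤-double-of-half : ∀ {a t N} → 2 * a ≤ N → N ≤ t + a → N ≤ 2 * t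
≤-double-of-half {a} {t} {N} 2a≤N N≤t+a = +-cancelʳ-≤ (2 * a) N (2 * t) (begin
  N + 2 * a       ≤⟨ +-monoʳ-≤ N 2a≤N ⟩
  N + N           ≡⟨ cong (N +_) (sym (+-identityʳ N)) ⟩
  2 * N           ≤⟨ *-monoʳ-≤ 2 N≤t+a ⟩
  2 * (t + a)     ≡⟨ *-distribˡ-+ 2 t a ⟩
  2 * t + 2 * a   ∎)
  where open ≤-Reasoning

𝟙-half*-≤ : ∀ a t {N} → N ≤ t + a → 𝟙 ⌊ 2 * a ≤? N ⌋ * N ≤ 2 * t
𝟙-half*-≤ a t {N} N≤t+a with 2 * a ≤? N
... | yes 2a≤N = ≤-trans (≤-reflexive (+-identityʳ N)) (≤-double-of-half {a} {t} 2a≤N N≤t+a)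
... | no _     = z≤n

∑-half-≤-0 : ∀ {k} (f : Fin k → ℕ) {N} → N ≡ 0 → ∑ (λ j → if ⌊ 2 * f j ≤? N ⌋ then f j else 0) ≡ 0
∑-half-≤-0 {k} f refl = trans (∑-cong (λ j → half-≤-0 (f j))) (∑-0 {k})
  where
  half-≤-0 : ∀ a → (if ⌊ 2 * a ≤? 0 ⌋ then a else 0) ≡ 0
  half-≤-0 zero    = refl
  half-≤-0 (suc a) = refl

*-cancelʳ-≤-unless-0 : ∀ {a b} n → (n ≡ 0 → a ≡ 0) → a * n ≤ b * n → a ≤ b
*-cancelʳ-≤-unless-0 zero    a≡0 _ = ≤-trans (≤-reflexive (a≡0 refl)) z≤n
*-cancelʳ-≤-unless-0 (suc n) _   le = *-cancelʳ-≤ _ _ (suc n) le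

separatedNeighbours : ∀ {n r} → Coloring n r → (Fin r → Bool) → Fin n → Fin n → ℕ
separatedNeighbours c P u w = count (λ v → P (c u v) ∧ not (c w u == c w v))

∑-𝟙*-distinguishing : ∀ {n r} (c : Coloring n r) (P : Fin r → Bool) u →
  ∑ (λ v → 𝟙 (P (c u v)) * distinguishing c u v) ≡ ∑ (separatedNeighbours c P u)
∑-𝟙*-distinguishing c P u = begin
  ∑ (λ v → 𝟙 (P (c u v)) * distinguishing c u v)
    ≡⟨ ∑-cong (λ v → *-distribˡ-∑ (𝟙 (P (c u v))) (λ w → 𝟙 (not (c w u == c w v)))) ⟩
  ∑ (λ v → ∑ (λ w → 𝟙 (P (c u v)) * 𝟙 (not (c w u == c w v))))
    ≡⟨ ∑-cong (λ v → ∑-cong (λ w → sym (𝟙-∧ (P (c u v)) (not (c w u == c w v))))) ⟩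
  ∑ (λ v → ∑ (λ w → 𝟙 (P (c u v) ∧ not (c w u == c w v))))
    ≡⟨ ∑-comm (λ v w → 𝟙 (P (c u v) ∧ not (c w u == c w v))) ⟩
  ∑ (separatedNeighbours c P u) ∎
  where open ≡-Reasoning

module _ {m r} {c : Coloring m (suc r)} (pcc : IsPCC c) where
  open IsPCC pcc

  conv : Fin (suc r) → Fin (suc r)
  conv i = proj₁ (converse i)

  c-conv : ∀ x y → c y x ≡ conv (c x y)
  c-conv x y = Equivalence.to (proj₂ (converse (c x y)) x y) refl

  ==-conv : ∀ x y i → (c x y == i) ≡ (c y x == conv i)
  ==-conv x y i = ==-cong (to (proj₂ (converse i) x y)) (from (proj₂ (converse i) x y))
    where open Equivalence

  -- n_j = p^0_{j j*} at every vertex.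
  valency-uniform : ∀ x y j → valencyAt c x j ≡ valencyAt c y j
  valency-uniform x y j = trans (valency≡p x) (sym (valency≡p y))
    where
    p : ℕ
    p = proj₁ (intersection zero j (conv j))
    valency≡p : ∀ x → valencyAt c x j ≡ p
    valency≡p x = trans
      (∑-cong (λ w → cong 𝟙 (trans (sym (∧-idem _)) (cong ((c x w == j) ∧_) (==-conv x w j)))))
      (proj₂ (intersection zero j (conv j)) x x (Equivalence.from (diagonal x x) refl))

  valency-conv : ∀ x j → valencyAt c x (conv j) ≡ valencyAt c x j
  valency-conv x j = *-cancelˡ-≡ _ _ m {{nonZeroIndex x}} (begin
    m * valencyAt c x (conv j)                      ≡⟨ sym (∑-valency (conv j)) ⟩
    ∑ (λ w → ∑ (λ y → 𝟙 (c w y == conv j)))        ≡⟨ ∑-comm (λ w y → 𝟙 (c w y == conv j)) ⟩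
    ∑ (λ y → ∑ (λ w → 𝟙 (c w y == conv j)))        ≡⟨ ∑-cong (λ y → ∑-cong (λ w → cong 𝟙 (sym (==-conv y w j)))) ⟩
    ∑ (λ y → valencyAt c y j)                       ≡⟨ ∑-valency j ⟩
    m * valencyAt c x j                             ∎)
    where
    open ≡-Reasoning
    ∑-valency : ∀ i → ∑ (λ y → valencyAt c y i) ≡ m * valencyAt c x i
    ∑-valency i = trans (∑-cong (λ y → valency-uniform y x i)) (∑-const {m} (valencyAt c x i))

  valency-sym : ∀ x y z → valencyAt c x (c y z) ≡ valencyAt c x (c z y)
  valency-sym x y z = trans (sym (valency-conv x (c y z))) (cong (valencyAt c x) (sym (c-conv y z)))

  count-≤-separated+valency : ∀ P u w →
    count (λ v → P (c u v)) ≤ separatedNeighbours c P u w + valencyAt c u (c u w)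
  count-≤-separated+valency P u w =
    ≤-trans (count-split (λ v → P (c u v)) (λ v → c w u == c w v))
            (≤-reflexive (cong (separatedNeighbours c P u w +_) (begin
    count (λ v → c w u == c w v)  ≡⟨ ∑-cong (λ v → cong 𝟙 (==-sym (c w u) (c w v))) ⟩
    valencyAt c w (c w u)         ≡⟨ valency-uniform w u (c w u) ⟩
    valencyAt c u (c w u)         ≡⟨ valency-sym u w u ⟩
    valencyAt c u (c u w)         ∎)))
    where open ≡-Reasoning

  count-half-valency*-≤ : ∀ u P {N} → N ≤ count (λ v → P (c u v)) →
    count (λ w → ⌊ 2 * valencyAt c u (c u w) ≤? N ⌋) * N
      ≤ 2 * ∑ (λ v → 𝟙 (P (c u v)) * distinguishing c u v)
  count-half-valency*-≤ u P {N} N≤nP = begin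
    count (λ w → inJ w) * N                 ≡⟨ *-distribʳ-∑ N (λ w → 𝟙 (inJ w)) ⟩
    ∑ (λ w → 𝟙 (inJ w) * N)                ≤⟨ ∑-mono-≤ half-bound ⟩
    ∑ (λ w → 2 * separatedNeighbours c P u w) ≡⟨ sym (*-distribˡ-∑ 2 (separatedNeighbours c P u)) ⟩
    2 * ∑ (separatedNeighbours c P u)       ≡⟨ cong (2 *_) (sym (∑-𝟙*-distinguishing c P u)) ⟩
    2 * ∑ (λ v → 𝟙 (P (c u v)) * distinguishing c u v) ∎
    where
    open ≤-Reasoning
    inJ : Fin m → Bool
    inJ w = ⌊ 2 * valencyAt c u (c u w) ≤? N ⌋
    half-bound : ∀ w → 𝟙 (inJ w) * N ≤ 2 * separatedNeighbours c P u w
    half-bound w = 𝟙-half*-≤ (valencyAt c u (c u w)) (separatedNeighbours c P u w)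
                             (≤-trans N≤nP (count-≤-separated+valency P u w))

lemma5p6 : ∀ {m r} (c : Coloring (suc m) (suc r)) → IsPCC c →
    (u : Fin (suc m)) (D : Fin (suc r) → ℕ) →
    (∀ x y → D (c x y) ≡ distinguishing c x y) →
    (I : Subset (suc r)) → Nonempty I → zero ∉ I →
    let nI = sumOn I (valencyAt c u) in
    ∑ (λ j → if ⌊ 2 * valencyAt c u j ≤? nI ⌋ then valencyAt c u j else 0)
      ≤ 2 * maxOn I D
lemma5p6 c pcc u D hD I _ _ = *-cancelʳ-≤-unless-0 nI (∑-half-≤-0 n) (begin
  L * nI                                            ≡⟨ cong (_* nI) (count-fibres inJ (c u)) ⟩
  count (λ w → inJ (c u w)) * nI                    ≤⟨ count-half-valency*-≤ pcc u inI (≤-reflexive nI≡) ⟩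
  2 * ∑ (λ v → 𝟙 (inI (c u v)) * distinguishing c u v)
                                                    ≡⟨ cong (2 *_) (∑-cong (λ v → cong (𝟙 (inI (c u v)) *_) (sym (hD u v)))) ⟩
  2 * ∑ (λ v → 𝟙 (inI (c u v)) * D (c u v))        ≤⟨ *-monoʳ-≤ 2 (∑-𝟙*-≤-count* inI D (c u) (≤-maxOver _)) ⟩
  2 * (count (λ v → inI (c u v)) * M)               ≡⟨ cong (λ k → 2 * (k * M)) (sym nI≡) ⟩
  2 * (nI * M)                                      ≡⟨ trans (cong (2 *_) (*-comm nI M)) (sym (*-assoc 2 M nI)) ⟩
  2 * M * nI                                        ∎)
  where
  open ≤-Reasoning
  n : Fin _ → ℕ
  n = valencyAt c u
  inI : Fin _ → Bool
  inI i = ⌊ i ∈? I ⌋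
  nI M L : ℕ
  nI = sumOn I n
  M  = maxOn I D
  inJ : Fin _ → Bool
  inJ j = ⌊ 2 * n j ≤? nI ⌋
  L = ∑ (λ j → if inJ j then n j else 0)
  nI≡ : nI ≡ count (λ v → inI (c u v))
  nI≡ = count-fibres inI (c u)
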